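{- Let $g\colon\mathbb{N}\to\mathbb{N}$ be any non-decreasing unbounded function. Then $\mu$ is a shell numbering for $\phi_g$; that is, for all $(x_1,y_1),(x_2,y_2)\in\mathbb{N}^2$, $\mu(x_1,y_1)<\mu(x_2,y_2)$ implies $\phi_g(x_1,y_1)<\phi_g(x_2,y_2)$.
   Context: $\mathbb{N}$ denotes the non-negative integers. $g$ is non-decreasing if $x\le y$ implies $g(x)\le g(y)$, and unbounded if for every $y$ there is $x$ with $g(x)\ge y$. Define $g^+(y)$ to be the smallest $x\in\mathbb{N}$ with $g(x)\ge y$. The step points of $g$ are the elements of the range of $g^+$, listed as $s_0<s_1<s_2<\cdots$. For $k\in\mathbb{N}$ let $B_k=\{0,1,\ldots,s_{k+1}(g(s_k)+1)-1\}$. Define $\phi_g(x,y)=y\cdot g^+(y)+x$ if $y>g(x)$, and $\phi_g(x,y)=x(g(x)+1)+y$ otherwise. For $(x,y)\in\mathbb{N}^2$, $\mu(x,y)$ is the smallest non-negative integer $k$ such that $\phi_g(x,y)\in B_k$. -}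

module Defs where

open import Data.Nat using (ℕ; suc; _+_; _*_; _≤_; _<_; _<?_)
open import Data.Product using (Σ; ∃; _×_)
open import Relation.Nullary using (¬_; yes; no)
open import Relation.Binary.PropositionalEquality using (_≡_)
open import Function.Bundles using (_⇔_)

NonDecreasing : (ℕ → ℕ) → Set
NonDecreasing g = ∀ x y → x ≤ y → g x ≤ g y

Unbounded : (ℕ → ℕ) → Set
Unbounded g = ∀ y → ∃ λ x → y ≤ g x

IsGPlus : (ℕ → ℕ) → (ℕ → ℕ) → Set
IsGPlus g gp = ∀ y → (y ≤ g (gp y)) × (∀ x → y ≤ g x → gp y ≤ x)

IsStepEnumeration : (ℕ → ℕ) → (ℕ → ℕ) → Set
IsStepEnumeration gp s =
  (∀ k → s k < s (suc k)) × (∀ x → (∃ λ y → gp y ≡ x) ⇔ (∃ λ k → s k ≡ x))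

InB : (ℕ → ℕ) → (ℕ → ℕ) → ℕ → ℕ → Set
InB g s k n = n < s (suc k) * (g (s k) + 1)

phi : (ℕ → ℕ) → (ℕ → ℕ) → ℕ → ℕ → ℕ
phi g gp x y with g x <? y
... | yes _ = y * gp y + x
... | no  _ = x * (g x + 1) + y

IsMu : (ℕ → ℕ) → (ℕ → ℕ) → (ℕ → ℕ) → ℕ → ℕ → ℕ → Set
IsMu g gp s x y k = InB g s k (phi g gp x y) × (∀ j → j < k → ¬ InB g s j (phi g gp x y))

module Submission where

-- Each shell B_k = {0, …, b k - 1} is an initial segment of ℕ,
-- with bound b k = s (k+1) * (g (s k) + 1).  If μ(x₁,y₁) = k₁ < k₂ = μ(x₂,y₂),
-- then φ(x₁,y₁) lies in B_{k₁}, while minimality of k₂ says φ(x₂,y₂) does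
-- not; hence φ(x₁,y₁) < b k₁ ≤ φ(x₂,y₂).

open import Defs
open import Data.Nat using (ℕ; _<_)
open import Data.Nat.Properties using (<-≤-trans; ≮⇒≥)
open import Data.Product using (_,_)
open import Relation.Nullary using (¬_)

inside<outside : ∀ {b m n} → m < b → ¬ n < b → m < n
inside<outside m<b n≮b = <-≤-trans m<b (≮⇒≥ n≮b)

theorem4p9 : (g gp s : ℕ → ℕ) → NonDecreasing g → Unbounded g
    → IsGPlus g gp → IsStepEnumeration gp s
    → ∀ x₁ y₁ x₂ y₂ k₁ k₂
    → IsMu g gp s x₁ y₁ k₁ → IsMu g gp s x₂ y₂ k₂
    → k₁ < k₂ → phi g gp x₁ y₁ < phi g gp x₂ y₂
theorem4p9 g gp s _ _ _ _ x₁ y₁ x₂ y₂ k₁ k₂ (φ₁∈B₁ , _) (_ , k₂-least) k₁<k₂ =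
  inside<outside φ₁∈B₁ (k₂-least k₁ k₁<k₂)
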